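{- Let $n\ge1$ and $m\ge n+1$. For $k=1,\dots,n$ let $\bar{\mathbf{w}}_k\in\mathbb{N}_0^n$ be the vector whose first $k$ entries equal $1$ and whose remaining $n-k$ entries equal $0$. Then the antiplurality equivalence classes $\mathcal{E}^{r^A}_{\bar{\mathbf{w}}_1,m},\dots,\mathcal{E}^{r^A}_{\bar{\mathbf{w}}_n,m}$ are pairwise distinct, and they are exactly the equivalence classes partitioning $\mathbb{N}_0^n\setminus\{\mathbf{0}\}$; i.e., the partition of $\mathbb{N}_0^n\setminus\{\mathbf{0}\}$ into antiplurality equivalence classes consists of exactly $n$ classes, identified by $\bar{\mathbf{w}}_1,\dots,\bar{\mathbf{w}}_n$.
   Context: Players $N=\{1,\dots,n\}$; alternatives $A=\{a_1,\dots,a_m\}$; $\mathcal{P}(A)$ is the set of strict linear orders on $A$; a profile is $\mathbf{P}=(P_1,\dots,P_n)$. For $\mathbf{w}\in\mathbb{N}_0^n\setminus\{\mathbf{0}\}$, the weighted antiplurality rule $r^A|\mathbf{w}(\mathbf{P})$ selects the alternative $a$ minimizing $\sum_{i:\,a\text{ ranked last by }P_i}w_i$, ties broken lexicographically (smallest index wins); for $\mathbf{w}=\mathbf{0}$, $r^A|\mathbf{0}\equiv a_1$. Structural equivalence: $(r,\mathbf{w})\sim_m(r,\mathbf{w}')$ means there exist bijections $\pi:N\to N$ and $\tilde\pi:A\to A$ such that for every profile $\mathbf{P}$, with $\mathbf{P}'$ defined by $\tilde\pi(a_j)\,P'_{\pi(i)}\,\tilde\pi(a_k)\iff a_jP_ia_k$,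 one has $\tilde\pi(r|\mathbf{w}(\mathbf{P}))=r|\mathbf{w}'(\mathbf{P}')$. The class of $\bar{\mathbf{w}}$ is $\mathcal{E}^r_{\bar{\mathbf{w}},m}=\{\mathbf{w}\in\mathbb{N}_0^n:(r,\mathbf{w})\sim_m(r,\bar{\mathbf{w}})\}$. -}

module Defs where

open import Data.Nat using (ℕ; zero; suc; _+_; _∸_; _≤ᵇ_; _<_; NonZero)
open import Data.Nat.Base using (_≡ᵇ_)
open import Data.Fin using (Fin; zero; suc; toℕ)
open import Data.Fin.Permutation using (Permutation′; _⟨$⟩ʳ_; _⟨$⟩ˡ_; _∘ₚ_)
open import Data.Bool using (Bool; true; false; if_then_else_; _∧_)
open import Data.Product using (Σ; ∃; _×_; _,_)
open import Relation.Binary.PropositionalEquality using (_≡_)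

-- A strict linear order on the alternatives Fin m is represented by a ranking
-- σ : Permutation′ m, where σ ⟨$⟩ʳ p is the alternative at position p
-- (position 0 = top).  The position of alternative a is σ ⟨$⟩ˡ a.
Order : ℕ → Set
Order m = Permutation′ m

_≺[_]_ : ∀ {m} → Fin m → Order m → Fin m → Set
a ≺[ σ ] b = toℕ (σ ⟨$⟩ˡ a) < toℕ (σ ⟨$⟩ˡ b)

isLast : ∀ {m} → Order m → Fin m → Bool
isLast {m} σ a = toℕ (σ ⟨$⟩ˡ a) ≡ᵇ (m ∸ 1)

Profile : ℕ → ℕ → Set
Profile n m = Fin n → Order m

Weights : ℕ → Set
Weights n = Fin n → ℕ

sumFin : ∀ {n} → (Fin n → ℕ) → ℕ
sumFin {zero} f = 0
sumFin {suc n} f = f zero + sumFin (λ i → f (suc i))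

isZeroVec : ∀ {n} → Weights n → Bool
isZeroVec {zero} w = true
isZeroVec {suc n} w = (w zero ≡ᵇ 0) ∧ isZeroVec (λ i → w (suc i))

argmin : ∀ {m} → .{{NonZero m}} → (Fin m → ℕ) → Fin m
argmin {suc zero} f = zero
argmin {suc (suc k)} f with argmin {suc k} (λ i → f (suc i))
... | j = if f zero ≤ᵇ f (suc j) then zero else suc j

score : ∀ {n m} → Weights n → Profile n m → Fin m → ℕ
score w P a = sumFin (λ i → if isLast (P i) a then w i else 0)

-- weighted antiplurality rule r^A | w (lexicographic tie-breaking);
-- for w = 0 the rule constantly returns a₁
antiplurality : ∀ {n m} → .{{NonZero m}} → Weights n → Profile n m → Fin m
antiplurality {n} {suc k} w P =
  if isZeroVec w then zero else argmin (score w P)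

-- relabelled profile P': P'_{π(i)} = π̃ ∘ P_i, i.e.
-- π̃(a_j) P'_{π(i)} π̃(a_k)  iff  a_j P_i a_k
relabel : ∀ {n m} → Permutation′ n → Permutation′ m → Profile n m → Profile n m
relabel π π̃ P i′ = P (π ⟨$⟩ˡ i′) ∘ₚ π̃

StructEquiv : ∀ n m → .{{NonZero m}} → Weights n → Weights n → Set
StructEquiv n m w w′ =
  Σ (Permutation′ n) λ π → Σ (Permutation′ m) λ π̃ →
    (P : Profile n m) →
      π̃ ⟨$⟩ʳ antiplurality w P ≡ antiplurality w′ (relabel π π̃ P)

-- w̄_k for k = toℕ k′ + 1 : first k entries 1, the rest 0
wbar : ∀ {n} → Fin n → Weights n
wbar k i = if toℕ i ≤ᵇ toℕ k then 1 else 0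

-- With fewer voters than alternatives some alternative is ranked last by nobody, so the weighted
-- antiplurality winner is the least alternative that no player of positive weight ranks last: the
-- rule sees w only through its support. Permuting the players therefore carries any w ≠ 0 onto
-- w̄_k, k the size of its support. Conversely a structural equivalence maps the support of w onto
-- that of w′, so w̄_k and w̄_l are equivalent only if k = l (pigeonhole); and the zero vector
-- elects a₁ even when every voter ranks a₁ last, which no rule with a voter of positive weight does.
module Submission where

open import Defs
open import Data.Nat using (ℕ; _≤_; _<_; NonZero)
open import Data.Fin using (Fin)
open import Data.Product using (_×_; ∃)
open import Relation.Binary.PropositionalEquality using (_≡_; _≢_)
open import Relation.Nullary using (¬_)

open import Data.Bool using (true; false; if_then_else_; T)
open import Data.Bool.Properties using (T?)
open import Data.Empty using (⊥-elim)
open import Data.Fin using (zero; suc; toℕ; fromℕ; fromℕ<; inject≤; punchIn) renaming (_<_ to _<ᶠ_)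
open import Data.Fin.Properties
  using (_≟_; toℕ-injective; toℕ-fromℕ; toℕ-fromℕ<; toℕ<n; toℕ-inject≤; inject≤-injective;
         injective⇒≤; pigeonhole; 0≢1+n; any?; all?; ¬∀⟶∃¬; <-cmp)
  renaming (<-irrefl to <ᶠ-irrefl)
open import Data.Fin.Permutation
  using (Permutation; Permutation′; _⟨$⟩ʳ_; _⟨$⟩ˡ_; inverseˡ; inverseʳ; flip; transpose; insert; lift₀; insert-punchIn)
  renaming (id to idₚ)
open import Data.Nat.Properties
  using (≤-refl; ≤-trans; m≤n⇒m≤1+n; <⇒≱; ≤-reflexive; <⇒≤; ≰⇒>; ≤-pred; n≮0; n≤0⇒n≡0; ≤ᵇ⇒≤; ≤⇒≤ᵇ; ≡ᵇ⇒≡; ≡⇒≡ᵇ; m+n≡0⇒m≡0; m+n≡0⇒n≡0)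
  renaming (_≟_ to _≟ℕ_; ≤-antisym to ≤ℕ-antisym)
open import Data.Nat using (zero; suc; s≤s; z≤n; _≡ᵇ_; _≤ᵇ_)
open import Data.Product using (∃₂; _,_; proj₁; proj₂)
open import Function using (_∘_)
open import Function.Bundles using (_⇔_; mk⇔; Equivalence)
open import Function.Definitions using (Injective)
open import Relation.Binary using (tri<; tri≈; tri>)
open import Relation.Binary.PropositionalEquality using (refl; sym; trans; cong; cong₂; subst; module ≡-Reasoning)
open import Relation.Nullary using (yes; no; does; ¬?)
open import Relation.Nullary.Decidable using (dec-true; dec-false; _×-dec_; decidable-stable; map′)
open import Relation.Unary using (Pred; Decidable)

open Equivalence using (to; from)

sumFin≡0⇒ : ∀ {n} (g : Fin n → ℕ) → sumFin g ≡ 0 → ∀ i → g i ≡ 0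
sumFin≡0⇒ {suc n} g s≡0 zero = m+n≡0⇒m≡0 (g zero) s≡0
sumFin≡0⇒ {suc n} g s≡0 (suc i) = sumFin≡0⇒ (g ∘ suc) (m+n≡0⇒n≡0 (g zero) s≡0) i

sumFin-≡0 : ∀ {n} (g : Fin n → ℕ) → (∀ i → g i ≡ 0) → sumFin g ≡ 0
sumFin-≡0 {zero} g g≡0 = refl
sumFin-≡0 {suc n} g g≡0 rewrite g≡0 zero = sumFin-≡0 (g ∘ suc) (g≡0 ∘ suc)

isZeroVec⇒≡0 : ∀ {n} (w : Weights n) → T (isZeroVec w) → ∀ i → w i ≡ 0
isZeroVec⇒≡0 {suc n} w t i with w zero ≡ᵇ 0 in w₀≡ᵇ0
isZeroVec⇒≡0 {suc n} w t zero | true = ≡ᵇ⇒≡ _ 0 (subst T (sym w₀≡ᵇ0) _)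
isZeroVec⇒≡0 {suc n} w t (suc i) | true = isZeroVec⇒≡0 (w ∘ suc) t i

argmin-≤ : ∀ {m} .{{_ : NonZero m}} (f : Fin m → ℕ) b → f (argmin f) ≤ f b
argmin-≤ {suc zero} f zero = ≤-refl
argmin-≤ {suc (suc k)} f b with argmin {suc k} (f ∘ suc) | argmin-≤ {suc k} (f ∘ suc)
... | j | ih with f zero ≤ᵇ f (suc j) in test
argmin-≤ f zero | j | ih | true = ≤-refl
argmin-≤ f (suc b) | j | ih | true = ≤-trans (≤ᵇ⇒≤ _ _ (subst T (sym test) _)) (ih b)
argmin-≤ f zero | j | ih | false = <⇒≤ (≰⇒> λ f₀≤ → subst T test (≤⇒≤ᵇ f₀≤))
argmin-≤ f (suc b) | j | ih | false = ih b

argmin-leftmost : ∀ {m} .{{_ : NonZero m}} (f : Fin m → ℕ) {b} → b <ᶠ argmin f → f (argmin f) < f b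
argmin-leftmost {suc zero} f ()
argmin-leftmost {suc (suc k)} f {b} with argmin {suc k} (f ∘ suc) | argmin-leftmost {suc k} (f ∘ suc)
... | j | ih with f zero ≤ᵇ f (suc j) in test
argmin-leftmost f {zero} | j | ih | false = λ _ → ≰⇒> λ f₀≤ → subst T test (≤⇒≤ᵇ f₀≤)
argmin-leftmost f {suc b} | j | ih | false = ih ∘ ≤-pred
argmin-leftmost f {b} | j | ih | true = λ ()

⟨$⟩ˡ-injective : ∀ {n} (π : Permutation′ n) → Injective _≡_ _≡_ (π ⟨$⟩ˡ_)
⟨$⟩ˡ-injective π {x} {y} eq = trans (sym (inverseʳ π)) (trans (cong (π ⟨$⟩ʳ_) eq) (inverseʳ π))

isLast-unique : ∀ {m} (σ : Order m) {a b} → T (isLast σ a) → T (isLast σ b) → a ≡ b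
isLast-unique σ a-last b-last =
  ⟨$⟩ˡ-injective σ (toℕ-injective (trans (≡ᵇ⇒≡ _ _ a-last) (sym (≡ᵇ⇒≡ _ _ b-last))))

rankingLast : ∀ {m} → Fin (suc m) → Order (suc m)
rankingLast {m} c = transpose (fromℕ m) c

rankingLast-last : ∀ {m} (c : Fin (suc m)) → T (isLast (rankingLast c) c)
rankingLast-last {m} c rewrite dec-true (c ≟ c) refl | toℕ-fromℕ m = ≡⇒≡ᵇ m m refl

unrankedLast-exists : ∀ {n m} → n < m → (P : Profile n m) → ∃ λ c → ∀ i → ¬ T (isLast (P i) c)
unrankedLast-exists {n} {m} n<m P with all? (λ c → any? (λ i → T? (isLast (P i) c)))
... | yes lastFor = ⊥-elim (distinct (pigeonhole n<m (proj₁ ∘ lastFor)))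
  where
  distinct : ¬ ∃₂ λ c c′ → c <ᶠ c′ × proj₁ (lastFor c) ≡ proj₁ (lastFor c′)
  distinct (c , c′ , c<c′ , same) = <ᶠ-irrefl
    (isLast-unique (P (proj₁ (lastFor c))) (proj₂ (lastFor c))
      (subst (λ i → T (isLast (P i) c′)) (sym same) (proj₂ (lastFor c′))))
    c<c′
... | no ¬lastFor with ¬∀⟶∃¬ m _ (λ c → any? (λ i → T? (isLast (P i) c))) ¬lastFor
... | c , ¬someLast = c , λ i c-last → ¬someLast (i , c-last)

record Vetoed {n m} (w : Weights n) (P : Profile n m) (a : Fin m) : Set where
  constructor vetoedBy
  field
    voter : Fin n
    supports : w voter ≢ 0
    ranksLast : T (isLast (P voter) a)

vetoed? : ∀ {n m} (w : Weights n) (P : Profile n m) → Decidable (Vetoed w P)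
vetoed? w P a = map′ (λ (i , wᵢ≢0 , a-last) → vetoedBy i wᵢ≢0 a-last)
                     (λ (vetoedBy i wᵢ≢0 a-last) → i , wᵢ≢0 , a-last)
                     (any? (λ i → ¬? (w i ≟ℕ 0) ×-dec T? (isLast (P i) a)))

record LeastUnvetoed {n m} (w : Weights n) (P : Profile n m) (a : Fin m) : Set where
  constructor leastUnvetoed
  field
    unvetoed : ¬ Vetoed w P a
    vetoed-below : ∀ {b} → b <ᶠ a → Vetoed w P b

leastUnvetoed-unique : ∀ {n m} {w : Weights n} {P : Profile n m} {a a′} →
  LeastUnvetoed w P a → LeastUnvetoed w P a′ → a ≡ a′
leastUnvetoed-unique {a = a} {a′} (leastUnvetoed ¬vₐ below) (leastUnvetoed ¬vₐ′ below′) with <-cmp a a′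
... | tri< a<a′ _ _ = ⊥-elim (¬vₐ (below′ a<a′))
... | tri≈ _ a≡a′ _ = a≡a′
... | tri> _ _ a′<a = ⊥-elim (¬vₐ′ (below a′<a))

leastUnvetoed-resp : ∀ {n m} {w w′ : Weights n} {P P′ : Profile n m} →
  (∀ b → Vetoed w P b ⇔ Vetoed w′ P′ b) → ∀ {a} → LeastUnvetoed w P a → LeastUnvetoed w′ P′ a
leastUnvetoed-resp same (leastUnvetoed ¬vₐ below) = leastUnvetoed (¬vₐ ∘ from (same _)) (to (same _) ∘ below)

unvetoed⇒score≡0 : ∀ {n m} (w : Weights n) (P : Profile n m) a → ¬ Vetoed w P a → score w P a ≡ 0
unvetoed⇒score≡0 w P a ¬v = sumFin-≡0 _ term≡0
  where
  term≡0 : ∀ i → (if isLast (P i) a then w i else 0) ≡ 0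
  term≡0 i with isLast (P i) a in a-last | w i ≟ℕ 0
  ... | false | _ = refl
  ... | true | yes wᵢ≡0 = wᵢ≡0
  ... | true | no wᵢ≢0 = ⊥-elim (¬v (vetoedBy i wᵢ≢0 (subst T (sym a-last) _)))

score≡0⇒unvetoed : ∀ {n m} (w : Weights n) (P : Profile n m) a → score w P a ≡ 0 → ¬ Vetoed w P a
score≡0⇒unvetoed w P a s≡0 (vetoedBy i wᵢ≢0 a-last) with isLast (P i) a | sumFin≡0⇒ _ s≡0 i
... | true | wᵢ≡0 = wᵢ≢0 wᵢ≡0

antiplurality-leastUnvetoed : ∀ {n m} → n < suc m → (w : Weights n) (P : Profile n (suc m)) →
  LeastUnvetoed w P (antiplurality w P)
antiplurality-leastUnvetoed n<m w P with isZeroVec w in w≡0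
... | true = leastUnvetoed (λ (vetoedBy i wᵢ≢0 _) → wᵢ≢0 (isZeroVec⇒≡0 w (subst T (sym w≡0) _) i)) λ ()
... | false = leastUnvetoed (score≡0⇒unvetoed w P a minScore≡0) vetoed-below
  where
  a = argmin (score w P)
  free = unrankedLast-exists n<m P
  minScore≡0 : score w P a ≡ 0
  minScore≡0 = n≤0⇒n≡0 (≤-trans (argmin-≤ (score w P) (proj₁ free))
    (≤-reflexive (unvetoed⇒score≡0 w P _ λ (vetoedBy i _ c-last) → proj₂ free i c-last)))
  vetoed-below : ∀ {b} → b <ᶠ a → Vetoed w P b
  vetoed-below {b} b<a = decidable-stable (vetoed? w P b) λ ¬v →
    n≮0 (subst (score w P a <_) (unvetoed⇒score≡0 w P b ¬v) (argmin-leftmost (score w P) b<a))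

antiplurality-≡ : ∀ {n m} → n < suc m → {w : Weights n} {P : Profile n (suc m)} {a : Fin (suc m)} →
  LeastUnvetoed w P a → antiplurality w P ≡ a
antiplurality-≡ n<m {w} {P} = leastUnvetoed-unique (antiplurality-leastUnvetoed n<m w P)

vetoed-cong : ∀ {n m} {w : Weights n} {P Q : Profile n m} →
  (∀ i a → isLast (P i) a ≡ isLast (Q i) a) → ∀ b → Vetoed w P b ⇔ Vetoed w Q b
vetoed-cong same b = mk⇔ (λ (vetoedBy i wᵢ≢0 b-last) → vetoedBy i wᵢ≢0 (subst T (same i b) b-last))
                         (λ (vetoedBy i wᵢ≢0 b-last) → vetoedBy i wᵢ≢0 (subst T (sym (same i b)) b-last))

antiplurality-cong : ∀ {n m} → n < suc m → (w : Weights n) {P Q : Profile n (suc m)} →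
  (∀ i a → isLast (P i) a ≡ isLast (Q i) a) → antiplurality w P ≡ antiplurality w Q
antiplurality-cong n<m w {P} {Q} same =
  sym (antiplurality-≡ n<m {P = Q} (leastUnvetoed-resp (vetoed-cong same) (antiplurality-leastUnvetoed n<m w P)))

record EquivalentVia {n m} (π : Permutation′ n) (π̃ : Permutation′ (suc m)) (w w′ : Weights n) : Set where
  constructor equivalentVia
  field
    winner-relabels : ∀ P → π̃ ⟨$⟩ʳ antiplurality w P ≡ antiplurality w′ (relabel π π̃ P)

isLast-relabel : ∀ {n m} (π : Permutation′ n) (π̃ : Permutation′ m) (P : Profile n m) j a →
  isLast (relabel π π̃ P j) (π̃ ⟨$⟩ʳ a) ≡ isLast (P (π ⟨$⟩ˡ j)) a
isLast-relabel π π̃ P j a = cong (isLast (P (π ⟨$⟩ˡ j))) (inverseˡ π̃)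

-- Relabelling back by the inverse permutations only yields a pointwise equal profile; that suffices
-- because the rule sees a profile only through who ranks what last (no function extensionality).
equivalentVia-sym : ∀ {n m} → n < suc m → {π : Permutation′ n} {π̃ : Permutation′ (suc m)} {w w′ : Weights n} →
  EquivalentVia π π̃ w w′ → EquivalentVia (flip π) (flip π̃) w′ w
equivalentVia-sym n<m {π} {π̃} {w} {w′} (equivalentVia winner-relabels) = equivalentVia winner-relabels⁻¹
  where
  open ≡-Reasoning
  winner-relabels⁻¹ : ∀ P → π̃ ⟨$⟩ˡ antiplurality w′ P ≡ antiplurality w (relabel (flip π) (flip π̃) P)
  winner-relabels⁻¹ P = begin
    π̃ ⟨$⟩ˡ antiplurality w′ P                   ≡⟨ cong (π̃ ⟨$⟩ˡ_) (antiplurality-cong n<m w′ {P} {relabel π π̃ Q} relabel-back) ⟩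
    π̃ ⟨$⟩ˡ antiplurality w′ (relabel π π̃ Q)     ≡⟨ cong (π̃ ⟨$⟩ˡ_) (sym (winner-relabels Q)) ⟩
    π̃ ⟨$⟩ˡ (π̃ ⟨$⟩ʳ antiplurality w Q)           ≡⟨ inverseˡ π̃ ⟩
    antiplurality w Q                            ∎
    where
    Q = relabel (flip π) (flip π̃) P
    relabel-back : ∀ i a → isLast (P i) a ≡ isLast (relabel π π̃ Q i) a
    relabel-back i a = sym (cong₂ (λ j b → isLast (P j) b) (inverseʳ π {i}) (inverseʳ π̃ {a}))

equivalentVia-winner-unvetoed : ∀ {n m} → n < suc m →
  {π : Permutation′ n} {π̃ : Permutation′ (suc m)} {w w′ : Weights n} → EquivalentVia π π̃ w w′ →
  (P : Profile n (suc m)) {a : Fin (suc m)} → antiplurality w P ≡ a →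
  ∀ {j} → w′ j ≢ 0 → ¬ T (isLast (P (π ⟨$⟩ˡ j)) a)
equivalentVia-winner-unvetoed n<m {π} {π̃} {w} {w′} (equivalentVia winner-relabels) P refl {j} w′ⱼ≢0 a-last =
  LeastUnvetoed.unvetoed (antiplurality-leastUnvetoed n<m w′ P′)
    (subst (Vetoed w′ P′) (winner-relabels P) (vetoedBy j w′ⱼ≢0 (subst T (sym (isLast-relabel π π̃ P j _)) a-last)))
  where
  P′ = relabel π π̃ P

vetoProfile : ∀ {n m} → Fin n → Fin (suc m) → Fin (suc m) → Profile n (suc m)
vetoProfile dissenter a c i = if does (i ≟ dissenter) then rankingLast a else rankingLast c

vetoProfile-dissenter : ∀ {n m} (dissenter : Fin n) (a c : Fin (suc m)) →
  T (isLast (vetoProfile dissenter a c dissenter) a)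
vetoProfile-dissenter dissenter a c rewrite dec-true (dissenter ≟ dissenter) refl = rankingLast-last a

vetoProfile-others : ∀ {n m} {dissenter i : Fin n} (a c : Fin (suc m)) → i ≢ dissenter →
  T (isLast (vetoProfile dissenter a c i) c)
vetoProfile-others {dissenter = dissenter} {i} a c i≢dissenter
  rewrite dec-false (i ≟ dissenter) i≢dissenter = rankingLast-last c

-- A non-supporter of w alone ranking a₁ last, with everyone else ranking a₀ last, makes a₁ win
-- under w; so its image under π cannot support w′.
support-reflected : ∀ {n m} → n < suc (suc m) →
  {π : Permutation′ n} {π̃ : Permutation′ (suc (suc m))} {w w′ : Weights n} → EquivalentVia π π̃ w w′ →
  ∀ i₀ j → w i₀ ≢ 0 → w′ j ≢ 0 → w (π ⟨$⟩ˡ j) ≢ 0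
support-reflected n<m {π} {w = w} equiv i₀ j wᵢ₀≢0 w′ⱼ≢0 w-dissenter≡0 =
  equivalentVia-winner-unvetoed n<m equiv P winner w′ⱼ≢0 (vetoProfile-dissenter dissenter (suc zero) zero)
  where
  dissenter = π ⟨$⟩ˡ j
  P : Profile _ (suc (suc _))
  P = vetoProfile dissenter (suc zero) zero
  supporter-agrees : ∀ {i} → w i ≢ 0 → T (isLast (P i) zero)
  supporter-agrees {i} wᵢ≢0 = vetoProfile-others {dissenter = dissenter} {i} (suc zero) zero
    λ { refl → wᵢ≢0 w-dissenter≡0 }
  winner : antiplurality w P ≡ suc zero
  winner = antiplurality-≡ n<m {w} {P} (leastUnvetoed
    (λ (vetoedBy i wᵢ≢0 1-last) → 0≢1+n (isLast-unique (P i) (supporter-agrees wᵢ≢0) 1-last))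
    λ { {zero} _ → vetoedBy i₀ wᵢ₀≢0 (supporter-agrees wᵢ₀≢0) ; {suc _} (s≤s ()) })

nonzero-reflected : ∀ {n m} → n < suc m →
  {π : Permutation′ n} {π̃ : Permutation′ (suc m)} {w w′ : Weights n} → EquivalentVia π π̃ w w′ →
  ∀ j → w′ j ≢ 0 → ¬ (∀ i → w i ≡ 0)
nonzero-reflected {n} {m} n<m {w = w} equiv j w′ⱼ≢0 w≡0 =
  equivalentVia-winner-unvetoed n<m equiv P winner w′ⱼ≢0 (rankingLast-last {m} zero)
  where
  P : Profile n (suc m)
  P _ = rankingLast zero
  winner : antiplurality w P ≡ zero
  winner = antiplurality-≡ n<m {w} {P} (leastUnvetoed (λ (vetoedBy i wᵢ≢0 _) → wᵢ≢0 (w≡0 i)) λ ())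

equivalentVia-support : ∀ {n m} → n < suc m → {w w′ : Weights n} (π : Permutation′ n) →
  (∀ i → w i ≢ 0 ⇔ w′ (π ⟨$⟩ʳ i) ≢ 0) → EquivalentVia {m = m} π idₚ w w′
equivalentVia-support n<m {w} {w′} π supp = equivalentVia λ P →
  sym (antiplurality-≡ n<m (leastUnvetoed-resp (same-vetoes P) (antiplurality-leastUnvetoed n<m w P)))
  where
  same-vetoes : ∀ P b → Vetoed w P b ⇔ Vetoed w′ (relabel π idₚ P) b
  same-vetoes P b = mk⇔
    (λ (vetoedBy i wᵢ≢0 b-last) → vetoedBy (π ⟨$⟩ʳ i) (to (supp i) wᵢ≢0)
      (subst (λ i′ → T (isLast (P i′) b)) (sym (inverseˡ π)) b-last))
    (λ (vetoedBy j w′ⱼ≢0 b-last) → vetoedBy (π ⟨$⟩ˡ j)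
      (from (supp _) (subst (λ j′ → w′ j′ ≢ 0) (sym (inverseʳ π)) w′ⱼ≢0)) b-last)

initialSegment-injection-≤ : ∀ {n n′} (ρ : Fin n → Fin n′) → Injective _≡_ _≡_ ρ → (k : Fin n) (l : Fin n′) →
  (∀ i → toℕ i ≤ toℕ k → toℕ (ρ i) ≤ toℕ l) → toℕ k ≤ toℕ l
initialSegment-injection-≤ ρ ρ-injective k l into = ≤-pred (injective⇒≤ restrict-injective)
  where
  open ≡-Reasoning
  k<n = toℕ<n k
  embed : Fin (suc (toℕ k)) → Fin _
  embed t = inject≤ t k<n
  embed-≤ : ∀ t → toℕ (embed t) ≤ toℕ k
  embed-≤ t = ≤-trans (≤-reflexive (toℕ-inject≤ t k<n)) (≤-pred (toℕ<n t))
  restrict : Fin (suc (toℕ k)) → Fin (suc (toℕ l))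
  restrict t = fromℕ< (s≤s (into (embed t) (embed-≤ t)))
  restrict-injective : Injective _≡_ _≡_ restrict
  restrict-injective {t} {t′} eq = inject≤-injective k<n k<n t t′ (ρ-injective (toℕ-injective (begin
    toℕ (ρ (embed t))   ≡⟨ toℕ-fromℕ< _ ⟨
    toℕ (restrict t)    ≡⟨ cong toℕ eq ⟩
    toℕ (restrict t′)   ≡⟨ toℕ-fromℕ< _ ⟩
    toℕ (ρ (embed t′))  ∎)))

toℕ-punchIn-fromℕ : ∀ {n} (x : Fin n) → toℕ (punchIn (fromℕ n) x) ≡ toℕ x
toℕ-punchIn-fromℕ zero = refl
toℕ-punchIn-fromℕ (suc x) = cong suc (toℕ-punchIn-fromℕ x)

insert-lookup : ∀ {m n} (i : Fin (suc m)) (j : Fin (suc n)) (π : Permutation m n) → insert i j π ⟨$⟩ʳ i ≡ j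
insert-lookup i j π with i ≟ i
... | yes _ = refl
... | no i≢i = ⊥-elim (i≢i refl)

-- Player 0 goes to the front if it belongs to A and to the very end otherwise.
moveToFront : ∀ {n ℓ} (A : Pred (Fin n) ℓ) → Decidable A →
  ∃₂ λ (π : Permutation′ n) c → c ≤ n × (∀ i → A i ⇔ toℕ (π ⟨$⟩ʳ i) < c)
moveToFront {zero} A A? = idₚ , 0 , z≤n , λ ()
moveToFront {suc n} A A? with moveToFront (A ∘ suc) (A? ∘ suc) | A? zero
... | π , c , c≤n , front | yes A₀ = lift₀ π , suc c , s≤s c≤n , λ where
    zero → mk⇔ (λ _ → s≤s z≤n) (λ _ → A₀)
    (suc i) → mk⇔ (s≤s ∘ to (front i)) (from (front i) ∘ ≤-pred)
... | π , c , c≤n , front | no ¬A₀ = insert zero (fromℕ n) π , c , m≤n⇒m≤1+n c≤n , λ where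
    zero → mk⇔ (⊥-elim ∘ ¬A₀) λ last<c → ⊥-elim (<⇒≱ (subst (_< c) last≡n last<c) c≤n)
    (suc i) → mk⇔ (subst (_< c) (sym (shift i)) ∘ to (front i)) (from (front i) ∘ subst (_< c) (shift i))
  where
  last≡n : toℕ (insert zero (fromℕ n) π ⟨$⟩ʳ zero) ≡ n
  last≡n = trans (cong toℕ (insert-lookup zero (fromℕ n) π)) (toℕ-fromℕ n)
  shift : ∀ i → toℕ (insert zero (fromℕ n) π ⟨$⟩ʳ suc i) ≡ toℕ (π ⟨$⟩ʳ i)
  shift i = trans (cong toℕ (insert-punchIn zero (fromℕ n) π i)) (toℕ-punchIn-fromℕ (π ⟨$⟩ʳ i))

wbar-supports : ∀ {n} {k i : Fin n} → wbar k i ≢ 0 ⇔ toℕ i ≤ toℕ k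
wbar-supports {k = k} {i} with toℕ i ≤ᵇ toℕ k in test
... | true = mk⇔ (λ _ → ≤ᵇ⇒≤ _ _ (subst T (sym test) _)) (λ _ ())
... | false = mk⇔ (λ 0≢0 → ⊥-elim (0≢0 refl)) (λ i≤k → ⊥-elim (subst T test (≤⇒≤ᵇ i≤k)))

wbar-self : ∀ {n} (k : Fin n) → wbar k k ≢ 0
wbar-self k = from (wbar-supports {k = k} {k}) ≤-refl

wbar-equivalentVia⇒≤ : ∀ {n m} → n < suc (suc m) →
  {π : Permutation′ n} {π̃ : Permutation′ (suc (suc m))} {k l : Fin n} →
  EquivalentVia π π̃ (wbar k) (wbar l) → toℕ l ≤ toℕ k
wbar-equivalentVia⇒≤ n<m {π} {k = k} {l} equiv =
  initialSegment-injection-≤ (π ⟨$⟩ˡ_) (⟨$⟩ˡ-injective π) l k λ j j≤l →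
    to wbar-supports (support-reflected n<m equiv k j (wbar-self k) (from wbar-supports j≤l))

wbar-inequivalent : ∀ {n m} → n < suc (suc m) → {k l : Fin n} → k ≢ l →
  ¬ StructEquiv n (suc (suc m)) (wbar k) (wbar l)
wbar-inequivalent n<m {k} {l} k≢l (π , π̃ , winner-relabels) = k≢l (toℕ-injective (≤ℕ-antisym
  (wbar-equivalentVia⇒≤ n<m (equivalentVia-sym n<m equiv)) (wbar-equivalentVia⇒≤ n<m equiv)))
  where
  equiv : EquivalentVia π π̃ (wbar k) (wbar l)
  equiv = equivalentVia winner-relabels

equivalent-to-wbar : ∀ {n m} → n < suc m → (w : Weights n) → ¬ (∀ i → w i ≡ 0) →
  ∃ λ k → StructEquiv n (suc m) w (wbar k)
equivalent-to-wbar n<m w w≢0 with moveToFront (λ i → w i ≢ 0) (λ i → ¬? (w i ≟ℕ 0))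
... | π , zero , _ , front = ⊥-elim (w≢0 λ i → decidable-stable (w i ≟ℕ 0) (n≮0 ∘ to (front i)))
... | π , suc c , c<n , front = k , π , idₚ , EquivalentVia.winner-relabels (equivalentVia-support n<m π λ i → mk⇔
    (λ wᵢ≢0 → from wbar-supports (subst (_ ≤_) (sym k≡c) (≤-pred (to (front i) wᵢ≢0))))
    (λ nz → from (front i) (s≤s (subst (_ ≤_) k≡c (to wbar-supports nz)))))
  where
  k = fromℕ< c<n
  k≡c : toℕ k ≡ c
  k≡c = toℕ-fromℕ< c<n

proposition3 : (n m : ℕ) → .{{_ : NonZero m}} → 1 ≤ n → n < m →
    ((k l : Fin n) → k ≢ l → ¬ StructEquiv n m (wbar k) (wbar l))
    × ((w : Weights n) → ¬ (∀ i → w i ≡ 0) → ∃ λ (k : Fin n) → StructEquiv n m w (wbar k))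
    × ((k : Fin n) (w : Weights n) → StructEquiv n m w (wbar k) → ¬ (∀ i → w i ≡ 0))
proposition3 zero _ () _
proposition3 (suc n) zero _ ()
proposition3 (suc n) (suc zero) _ (s≤s ())
proposition3 (suc n) (suc (suc m)) _ n<m =
    (λ k l → wbar-inequivalent n<m)
  , equivalent-to-wbar n<m
  , λ k w (π , π̃ , winner-relabels) →
      nonzero-reflected n<m (equivalentVia {π = π} {π̃} {w} {wbar k} winner-relabels) k (wbar-self k)
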